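{- Let $m,n\ge 1$. Then for every integer $k\ge 1$, $\mu_k(K_{m,n})=m+n$, where $K_{m,n}$ is the complete bipartite graph with parts of sizes $m$ and $n$.
   Context: For a graph $G$, $X\subseteq V(G)$ and an integer $k\ge 0$, two vertices $u,v$ are $(X,k)$-visible if there exists a shortest $(u,v)$-path in $G$ having at most $k$ internal vertices in $X$. $X$ is a mutual $k$-visible set if every pair of distinct vertices of $X$ is $(X,k)$-visible; $\mu_k(G)$ is the maximum cardinality of a mutual $k$-visible set in $G$. -}

module Defs where

open import Data.Nat using (ℕ; zero; suc; _+_; _≤_; _<ᵇ_)
open import Data.Fin using (Fin; toℕ)
open import Data.Fin.Subset using (Subset; _∈_; ∣_∣; inside; outside)
open import Data.Vec using (lookup)
open import Data.Empty using (⊥)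
open import Data.Bool using (Bool; true; false)
open import Data.List using (List; []; _∷_; length)
open import Data.Product using (Σ; _×_; ∃)
open import Relation.Binary.PropositionalEquality using (_≡_; _≢_; refl; sym)

record Graph (N : ℕ) : Set₁ where
  field
    Adj    : Fin N → Fin N → Set
    symm   : ∀ {u v} → Adj u v → Adj v u
    irrefl : ∀ {u} → Adj u u → ⊥
open Graph public

data Walk {N : ℕ} (G : Graph N) : Fin N → Fin N → Set where
  []  : ∀ {u} → Walk G u u
  _∷_ : ∀ {u w v} → Adj G u w → Walk G w v → Walk G u v

len : ∀ {N} {G : Graph N} {u v} → Walk G u v → ℕ
len []      = 0
len (_ ∷ p) = suc (len p)

verts : ∀ {N} {G : Graph N} {u v} → Walk G u v → List (Fin N)
verts {u = u} []      = u ∷ []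
verts {u = u} (_ ∷ p) = u ∷ verts p

dropLast : ∀ {A : Set} → List A → List A
dropLast []           = []
dropLast (x ∷ [])     = []
dropLast (x ∷ y ∷ xs) = x ∷ dropLast (y ∷ xs)

internal : ∀ {N} {G : Graph N} {u v} → Walk G u v → List (Fin N)
internal []      = []
internal (_ ∷ p) = dropLast (verts p)

-- a shortest (u,v)-path: a (u,v)-walk of minimum length
-- (a minimum-length walk is automatically a path)
IsShortest : ∀ {N} (G : Graph N) {u v} → Walk G u v → Set
IsShortest G {u} {v} p = (q : Walk G u v) → len p ≤ len q

countIn : ∀ {N} → Subset N → List (Fin N) → ℕ
countIn X []       = 0
countIn X (x ∷ xs) with lookup X x
... | true  = suc (countIn X xs)
... | false = countIn X xs

Visible : ∀ {N} (G : Graph N) (X : Subset N) (k : ℕ) (u v : Fin N) → Set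
Visible G X k u v =
  Σ (Walk G u v) λ p → IsShortest G p × countIn X (internal p) ≤ k

MutualVisible : ∀ {N} (G : Graph N) (k : ℕ) (X : Subset N) → Set
MutualVisible G k X =
  ∀ u v → u ∈ X → v ∈ X → u ≢ v → Visible G X k u v

IsMu : ∀ {N : ℕ} (G : Graph N) (k : ℕ) (r : ℕ) → Set
IsMu {N} G k r =
  (Σ (Subset N) λ X → MutualVisible G k X × ∣ X ∣ ≡ r)
  × ((X : Subset N) → MutualVisible G k X → ∣ X ∣ ≤ r)

-- Complete bipartite graph K_{m,n} on Fin (m + n):
-- vertices with index < m form the first part (size m), the rest the second (size n);
-- two vertices are adjacent iff they lie in different parts.
side : (m : ℕ) {n : ℕ} → Fin (m + n) → Bool
side m i = toℕ i <ᵇ m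

K : (m n : ℕ) → Graph (m + n)
K m n = record
  { Adj    = λ i j → side m i ≢ side m j
  ; symm   = λ ne eq → ne (sym eq)
  ; irrefl = λ ne → ne refl
  }

-- Two distinct vertices of K_{m,n} are either adjacent or, since both parts are
-- nonempty, have a common neighbour in the other part. So every pair is joined by
-- a shortest path with at most one internal vertex, and for k ≥ 1 the whole vertex
-- set is mutually k-visible; no set can be larger.
module Submission where

open import Defs
open import Data.Bool using (true; false; not; _≟_)
open import Data.Bool.Properties using (not-¬)
open import Data.Empty using (⊥-elim)
open import Data.Fin using (Fin; zero; toℕ; fromℕ<)
open import Data.Fin.Properties using (toℕ-fromℕ<)
open import Data.Fin.Subset using (Subset; ⊤)
open import Data.Fin.Subset.Properties using (∣⊤∣≡n; ∣p∣≤n)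
open import Data.List using (List; []; _∷_; length)
open import Data.Vec using (lookup)
open import Data.Nat using (ℕ; zero; suc; _+_; _≤_; _<ᵇ_; z≤n; s≤s)
open import Data.Nat.Properties using (m<m+n; n≤1+n; ≤-trans)
open import Data.Product using (_×_; _,_; ∃-syntax)
open import Relation.Binary.PropositionalEquality using (_≡_; _≢_; refl; sym; trans; cong)
open import Relation.Nullary using (¬_; Dec; yes; no; ¬?)
open import Relation.Nullary.Decidable using (decidable-stable)

countIn≤length : ∀ {N} (X : Subset N) (xs : List (Fin N)) → countIn X xs ≤ length xs
countIn≤length X []       = z≤n
countIn≤length X (x ∷ xs) with lookup X x
... | true  = s≤s (countIn≤length X xs)
... | false = ≤-trans (countIn≤length X xs) (n≤1+n _)

module _ {N : ℕ} (G : Graph N) where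

  DiameterAtMost2 : Set
  DiameterAtMost2 = ∀ u v → u ≢ v → ¬ Adj G u v → ∃[ w ] Adj G u w × Adj G w v

  edge-isShortest : ∀ {u v} → u ≢ v → (e : Adj G u v) → IsShortest G (e ∷ [])
  edge-isShortest u≢v e []      = ⊥-elim (u≢v refl)
  edge-isShortest u≢v e (_ ∷ _) = s≤s z≤n

  twoStep-isShortest : ∀ {u w v} → u ≢ v → ¬ Adj G u v →
                       (e : Adj G u w) (f : Adj G w v) → IsShortest G (e ∷ f ∷ [])
  twoStep-isShortest u≢v ¬uv e f []          = ⊥-elim (u≢v refl)
  twoStep-isShortest u≢v ¬uv e f (uv ∷ [])   = ⊥-elim (¬uv uv)
  twoStep-isShortest u≢v ¬uv e f (_ ∷ _ ∷ _) = s≤s (s≤s z≤n)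

  adjacent-visible : ∀ {X k u v} → u ≢ v → Adj G u v → Visible G X k u v
  adjacent-visible u≢v e = e ∷ [] , edge-isShortest u≢v e , z≤n

  commonNeighbour-visible : ∀ {X k u w v} → 1 ≤ k → u ≢ v → ¬ Adj G u v →
                            Adj G u w → Adj G w v → Visible G X k u v
  commonNeighbour-visible {X} {w = w} 1≤k u≢v ¬uv e f =
    e ∷ f ∷ [] , twoStep-isShortest u≢v ¬uv e f , ≤-trans (countIn≤length X (w ∷ [])) 1≤k

  ⊤-mutualVisible : (∀ u v → Dec (Adj G u v)) → DiameterAtMost2 →
                    ∀ {k} → 1 ≤ k → MutualVisible G k ⊤
  ⊤-mutualVisible adj? diam 1≤k u v _ _ u≢v with adj? u v
  ... | yes uv = adjacent-visible u≢v uv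
  ... | no ¬uv = let w , e , f = diam u v u≢v ¬uv in
                 commonNeighbour-visible 1≤k u≢v ¬uv e f

  mutualVisible-⊤⇒isMu : ∀ {k} → MutualVisible G k ⊤ → IsMu G k N
  mutualVisible-⊤⇒isMu vis = (⊤ , vis , ∣⊤∣≡n N) , λ X _ → ∣p∣≤n X

n<ᵇn≡false : ∀ n → (n <ᵇ n) ≡ false
n<ᵇn≡false zero    = refl
n<ᵇn≡false (suc n) = n<ᵇn≡false n

vertex-onSide : ∀ {m n} → 1 ≤ m → 1 ≤ n → ∀ b → ∃[ w ] side m {n} w ≡ b
vertex-onSide {suc m} _ _   true  = zero , refl
vertex-onSide {m}     _ 1≤n false =
  fromℕ< (m<m+n m 1≤n) , trans (cong (_<ᵇ m) (toℕ-fromℕ< _)) (n<ᵇn≡false m)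

K-adj? : ∀ m n (u v : Fin (m + n)) → Dec (Adj (K m n) u v)
K-adj? m n u v = ¬? (side m u ≟ side m v)

K-diameterAtMost2 : ∀ {m n} → 1 ≤ m → 1 ≤ n → DiameterAtMost2 (K m n)
K-diameterAtMost2 {m} 1≤m 1≤n u v _ ¬uv =
  let w , side-w = vertex-onSide 1≤m 1≤n (not (side m u))
      uw : side m u ≢ side m w
      uw eq = not-¬ refl (trans eq side-w)
      same : side m u ≡ side m v
      same = decidable-stable (side m u ≟ side m v) ¬uv
  in w , uw , λ eq → uw (trans same (sym eq))

proposition4p5 : (m n : ℕ) → 1 ≤ m → 1 ≤ n → (k : ℕ) → 1 ≤ k → IsMu (K m n) k (m + n)
proposition4p5 m n 1≤m 1≤n k 1≤k =
  mutualVisible-⊤⇒isMu (K m n)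
    (⊤-mutualVisible (K m n) (K-adj? m n) (K-diameterAtMost2 1≤m 1≤n) 1≤k)
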